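{- Let $G$ be a connected graph with $n$ vertices and $m$ edges. If $\binom{n-t}{2}+t(n-t)\leq m\leq\binom{n-t}{2}+t(n-t)+(t-2)$ for some $t\in\{2,\ldots,n-1\}$, then $tmc(G)\leq m+n-t$. Moreover, the bound is sharp: for every such $n$, $t$ and $m$ there is a connected graph with $n$ vertices and $m$ edges whose total monochromatic connection number equals $m+n-t$.
   Context: All graphs are finite, simple and undirected; $\binom{1}{2}=0$. A graph is total-colored if all its edges and all its vertices are assigned colors. A path in a total-colored graph is a total monochromatic path if all its edges and all its internal vertices have the same color. A total-coloring of a connected graph $G$ is a TMC-coloring if any two vertices of $G$ are joined by a total monochromatic path. The total monochromatic connection number $tmc(G)$ of a connected graph $G$ is the maximum number of colors used in a TMC-coloring of $G$. -}

module Defs where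

open import Data.Nat using (ℕ; _<ᵇ_; _≤_; _+_; _∸_)
open import Data.Nat.Properties using () renaming (_≟_ to _≟ℕ_)
open import Data.Bool using (Bool; true; false; _∧_; if_then_else_)
open import Data.Fin using (Fin; toℕ)
open import Data.List using (List; []; _∷_; _++_; [_]; length; map; concatMap; allFin; deduplicate)
open import Data.List.Relation.Unary.All using (All)
open import Data.List.Relation.Unary.Unique.Propositional using (Unique)
open import Data.Product using (Σ; _×_; _,_; ∃; proj₁; proj₂)
open import Data.Unit using (⊤)
open import Relation.Binary.PropositionalEquality using (_≡_; _≢_)

record Graph (n : ℕ) : Set where
  field
    adj    : Fin n → Fin n → Bool
    adj-sym : ∀ i j → adj i j ≡ adj j i
    irrefl : ∀ i → adj i i ≡ false
open Graph public

edgeList : ∀ {n} → Graph n → List (Fin n × Fin n)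
edgeList {n} G =
  concatMap (λ i → concatMap (λ j →
      if (toℕ i <ᵇ toℕ j) ∧ adj G i j then [ (i , j) ] else [])
    (allFin n)) (allFin n)

numEdges : ∀ {n} → Graph n → ℕ
numEdges G = length (edgeList G)

Consecutive : ∀ {n} → (Fin n → Fin n → Set) → List (Fin n) → Set
Consecutive R [] = ⊤
Consecutive R (x ∷ []) = ⊤
Consecutive R (x ∷ y ∷ r) = R x y × Consecutive R (y ∷ r)

pathVertices : ∀ {n} → Fin n → List (Fin n) → Fin n → List (Fin n)
pathVertices u ws v = u ∷ ws ++ v ∷ []

IsPath : ∀ {n} → Graph n → Fin n → List (Fin n) → Fin n → Set
IsPath G u ws v =
  Unique (pathVertices u ws v) × Consecutive (λ x y → adj G x y ≡ true) (pathVertices u ws v)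

Connected : ∀ {n} → Graph n → Set
Connected {n} G = ∀ (u v : Fin n) → u ≢ v → ∃ λ ws → IsPath G u ws v

record TotalColoring (n : ℕ) : Set where
  field
    vcol : Fin n → ℕ
    ecol : Fin n → Fin n → ℕ
    ecol-sym : ∀ i j → ecol i j ≡ ecol j i
open TotalColoring public

IsTotalMonoPath : ∀ {n} → Graph n → TotalColoring n → Fin n → List (Fin n) → Fin n → Set
IsTotalMonoPath G κ u ws v =
  IsPath G u ws v ×
  (∃ λ c → All (λ w → vcol κ w ≡ c) ws ×
           Consecutive (λ x y → ecol κ x y ≡ c) (pathVertices u ws v))

IsTMC : ∀ {n} → Graph n → TotalColoring n → Set
IsTMC {n} G κ = ∀ (u v : Fin n) → u ≢ v → ∃ λ ws → IsTotalMonoPath G κ u ws v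

numColors : ∀ {n} → Graph n → TotalColoring n → ℕ
numColors {n} G κ =
  length (deduplicate _≟ℕ_
    (map (vcol κ) (allFin n) ++ map (λ e → ecol κ (proj₁ e) (proj₂ e)) (edgeList G)))

TmcEq : ∀ {n} → Graph n → ℕ → Set
TmcEq {n} G k =
  (Σ (TotalColoring n) λ κ → IsTMC G κ × numColors G κ ≡ k) ×
  (∀ (κ : TotalColoring n) → IsTMC G κ → numColors G κ ≤ k)

-- If a vertex u has a non-neighbour, a total monochromatic path to it has an
-- internal vertex x adjacent to u, and the edge ux has the colour of x. Charge u the edge ux,
-- except when x picks u in turn and x < u: then charge u itself, whose colour recurs at x.
-- Distinct such vertices are charged distinct elements and every colour survives on an
-- uncharged element, so with k such vertices at most n + m − k colours occur. All non-edges
-- join such vertices, so C(n,2) ≤ m + C(k,2), and the upper bound on m forces k ≥ t.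
--
-- Take d = n − t universal vertices, one further vertex joined to the next
-- J = m − C(d,2) − td vertices, and no other edges. Colour a universal hub and its t spokes to
-- the remaining vertices 0 and everything else distinctly: non-adjacent vertices meet through
-- the hub, and exactly m + n − t colours are used.

module Submission where

open import Defs
open import Data.Nat using (ℕ; zero; suc; _≤_; _<_; _+_; _*_; _∸_; z≤n; s≤s; _<ᵇ_; _≡ᵇ_)
open import Data.Nat.Properties
open import Data.Nat.Combinatorics using (_C_; nC1≡n; nCk+nC[k+1]≡[n+1]C[k+1])
open import Data.Nat.Tactic.RingSolver using (solve-∀)
open import Data.Bool using (Bool; true; false; _∧_; _∨_; not; if_then_else_; T)
import Data.Bool.Properties as Bool
open import Data.Unit using (tt)
open import Data.Fin as Fin using (Fin; toℕ)
import Data.Fin.Properties as Fin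
open import Data.Product using (Σ; _×_; _,_; proj₁; proj₂; ∃; uncurry)
import Data.Product.Properties as Product
open import Data.Sum using (_⊎_; inj₁; inj₂)
import Data.Sum.Properties as Sum
open import Data.List using (List; []; _∷_; _++_; [_]; length; map; concatMap; allFin; tabulate; filter; deduplicate)
open import Data.List.Properties using (length-++; length-map; length-tabulate; map-++; map-∘; filter-notAll)
open import Data.List.Relation.Unary.Any using (Any; here; there)
import Data.List.Relation.Unary.All as All
open import Data.List.Relation.Unary.AllPairs using ([]; _∷_)
open import Data.List.Relation.Unary.Unique.Propositional using (Unique)
import Data.List.Relation.Unary.Unique.Propositional.Properties as Unique
open import Data.List.Relation.Unary.Unique.DecPropositional.Properties using (deduplicate-!)
open import Data.List.Membership.Propositional using (_∈_; _∉_; find; lose)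
open import Data.List.Membership.Propositional.Properties
  using ( ∈-concatMap⁺; ∈-concatMap⁻; ∈-allFin; ∈-map⁺; ∈-map⁻; ∈-filter⁺; ∈-filter⁻
        ; ∈-deduplicate⁻; ∈-deduplicate⁺; ∈-++⁺ˡ; ∈-++⁺ʳ; ∈-++⁻)
open import Relation.Binary.PropositionalEquality
  using (_≡_; _≢_; refl; sym; trans; cong; cong₂; subst; module ≡-Reasoning)
open import Relation.Binary.Definitions using (DecidableEquality)
open import Relation.Nullary using (¬_; yes; no; does; ¬?; _×-dec_; contradiction)
open import Relation.Nullary.Decidable using (dec-true; dec-false)
open import Relation.Unary using (Decidable)
open import Algebra.Properties.CommutativeMonoid.Sum +-0-commutativeMonoid
  using (sum; sum-syntax; sum-cong-≗; ∑-distrib-+; sum-replicate-zero)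

𝟙 : Bool → ℕ
𝟙 true = 1
𝟙 false = 0

∧-true⁻ : ∀ {a b} → a ∧ b ≡ true → a ≡ true × b ≡ true
∧-true⁻ {true} {true} _ = refl , refl

not≡true⇒≡false : ∀ {b} → not b ≡ true → b ≡ false
not≡true⇒≡false {false} _ = refl

<ᵇ⇒<′ : ∀ {m n} → (m <ᵇ n) ≡ true → m < n
<ᵇ⇒<′ {m} {n} m<ᵇn = <ᵇ⇒< m n (subst T (sym m<ᵇn) tt)

<⇒<ᵇ′ : ∀ {m n} → m < n → (m <ᵇ n) ≡ true
<⇒<ᵇ′ {m} {n} = dec-true (m <? n)

<ᵇ≡false⇒≥ : ∀ {m n} → (m <ᵇ n) ≡ false → n ≤ m
<ᵇ≡false⇒≥ m≮ᵇn = ≮⇒≥ λ m<n → contradiction (trans (sym m≮ᵇn) (<⇒<ᵇ′ m<n)) λ ()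

≡ᵇ-sym : ∀ a b → (a ≡ᵇ b) ≡ (b ≡ᵇ a)
≡ᵇ-sym zero zero = refl
≡ᵇ-sym zero (suc b) = refl
≡ᵇ-sym (suc a) zero = refl
≡ᵇ-sym (suc a) (suc b) = ≡ᵇ-sym a b

∑-ones : ∀ n → ∑[ i < n ] 1 ≡ n
∑-ones zero = refl
∑-ones (suc n) = cong suc (∑-ones n)

∑-mono-≤ : ∀ {n} {f g : Fin n → ℕ} → (∀ i → f i ≤ g i) → sum f ≤ sum g
∑-mono-≤ {zero} f≤g = z≤n
∑-mono-≤ {suc n} f≤g = +-mono-≤ (f≤g Fin.zero) (∑-mono-≤ (λ i → f≤g (Fin.suc i)))

∑-count-< : ∀ {N K} → K ≤ N → ∑[ j < N ] 𝟙 (toℕ j <ᵇ K) ≡ K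
∑-count-< {N} {zero} _ = sum-replicate-zero N
∑-count-< {suc N} {suc K} (s≤s K≤N) = cong suc (∑-count-< K≤N)

∑-count-≥ : ∀ N K → ∑[ j < N ] 𝟙 (not (toℕ j <ᵇ K)) ≡ N ∸ K
∑-count-≥ zero K = sym (0∸n≡0 K)
∑-count-≥ (suc N) zero = ∑-ones (suc N)
∑-count-≥ (suc N) (suc K) = ∑-count-≥ N K

[1+n]C2≡n+nC2 : ∀ n → suc n C 2 ≡ n + n C 2
[1+n]C2≡n+nC2 n = begin
  suc n C 2         ≡⟨ nCk+nC[k+1]≡[n+1]C[k+1] n 1 ⟨
  n C 1 + n C 2     ≡⟨ cong (_+ n C 2) (nC1≡n n) ⟩
  n + n C 2         ∎
  where open ≡-Reasoning

C2-mono-≤ : ∀ {a b} → a ≤ b → a C 2 ≤ b C 2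
C2-mono-≤ {zero} _ = z≤n
C2-mono-≤ {suc a} {suc b} (s≤s a≤b) = begin
  suc a C 2   ≡⟨ [1+n]C2≡n+nC2 a ⟩
  a + a C 2   ≤⟨ +-mono-≤ a≤b (C2-mono-≤ a≤b) ⟩
  b + b C 2   ≡⟨ [1+n]C2≡n+nC2 b ⟨
  suc b C 2   ∎
  where open ≤-Reasoning

C2-+ : ∀ a b → (a + b) C 2 ≡ a C 2 + a * b + b C 2
C2-+ a zero = begin
  (a + 0) C 2           ≡⟨ cong (_C 2) (+-identityʳ a) ⟩
  a C 2                 ≡⟨ pad (a C 2) a ⟩
  a C 2 + a * 0 + 0     ∎
  where
  open ≡-Reasoning
  pad : ∀ x a → x ≡ x + a * 0 + 0
  pad = solve-∀
C2-+ a (suc b) = begin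
  (a + suc b) C 2                        ≡⟨ cong (_C 2) (+-suc a b) ⟩
  suc (a + b) C 2                        ≡⟨ [1+n]C2≡n+nC2 (a + b) ⟩
  a + b + (a + b) C 2                    ≡⟨ cong (a + b +_) (C2-+ a b) ⟩
  a + b + (a C 2 + a * b + b C 2)        ≡⟨ shuffle a b (a C 2) (b C 2) ⟩
  a C 2 + a * suc b + (b + b C 2)        ≡⟨ cong (a C 2 + a * suc b +_) ([1+n]C2≡n+nC2 b) ⟨
  a C 2 + a * suc b + suc b C 2          ∎
  where
  open ≡-Reasoning
  shuffle : ∀ a b x y → a + b + (x + a * b + y) ≡ x + a * suc b + (b + y)
  shuffle = solve-∀

-- Peeling off vertex 0 is definitional: pairCount (suc n) Q reduces to the number of
-- j with Q 0 (suc j) plus pairCount n applied to Q shifted by one in both arguments.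
pairCount : ∀ n → (Fin n → Fin n → Bool) → ℕ
pairCount n Q = ∑[ i < n ] ∑[ j < n ] 𝟙 ((toℕ i <ᵇ toℕ j) ∧ Q i j)

pairCount-false : ∀ n → pairCount n (λ _ _ → false) ≡ 0
pairCount-false zero = refl
pairCount-false (suc n) = cong₂ _+_ (sum-replicate-zero n) (pairCount-false n)

pairCount-split : ∀ n (Q R : Fin n → Fin n → Bool) →
  pairCount n (λ i j → Q i j ∧ R i j) + pairCount n (λ i j → Q i j ∧ not (R i j)) ≡ pairCount n Q
pairCount-split n Q R = trans (sym (∑-distrib-+ (row QR) (row QR′))) (sum-cong-≗ λ i →
  trans (sym (∑-distrib-+ (entry QR i) (entry QR′ i)))
        (sum-cong-≗ λ j → 𝟙-split (toℕ i <ᵇ toℕ j) (Q i j) (R i j)))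
  where
  QR QR′ : Fin n → Fin n → Bool
  QR i j = Q i j ∧ R i j
  QR′ i j = Q i j ∧ not (R i j)
  entry : (Fin n → Fin n → Bool) → Fin n → Fin n → ℕ
  entry P i j = 𝟙 ((toℕ i <ᵇ toℕ j) ∧ P i j)
  row : (Fin n → Fin n → Bool) → Fin n → ℕ
  row P i = ∑[ j < n ] entry P i j
  𝟙-split : ∀ l q r → 𝟙 (l ∧ q ∧ r) + 𝟙 (l ∧ q ∧ not r) ≡ 𝟙 (l ∧ q)
  𝟙-split false q r = refl
  𝟙-split true false r = refl
  𝟙-split true true true = refl
  𝟙-split true true false = refl

pairCount-mono-≤ : ∀ n {Q R : Fin n → Fin n → Bool} →
  (∀ i j → toℕ i < toℕ j → Q i j ≡ true → R i j ≡ true) → pairCount n Q ≤ pairCount n R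
pairCount-mono-≤ n {Q} {R} Q⇒R = ∑-mono-≤ λ i → ∑-mono-≤ λ j →
  𝟙-mono (toℕ i <ᵇ toℕ j) (Q i j) (R i j) (λ i<j → Q⇒R i j (<ᵇ⇒<′ i<j))
  where
  𝟙-mono : ∀ l q r → (l ≡ true → q ≡ true → r ≡ true) → 𝟙 (l ∧ q) ≤ 𝟙 (l ∧ r)
  𝟙-mono false q r _ = z≤n
  𝟙-mono true false r _ = z≤n
  𝟙-mono true true r q⇒r rewrite q⇒r refl refl = ≤-refl

pairCount-both : ∀ n (p : Fin n → Bool) →
  pairCount n (λ i j → p i ∧ p j) ≡ (∑[ i < n ] 𝟙 (p i)) C 2
pairCount-both zero p = refl
pairCount-both (suc n) p = peel (p Fin.zero)
  where
  k : ℕ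
  k = ∑[ i < n ] 𝟙 (p (Fin.suc i))
  rest : pairCount n (λ i j → p (Fin.suc i) ∧ p (Fin.suc j)) ≡ k C 2
  rest = pairCount-both n (λ i → p (Fin.suc i))
  peel : ∀ b → ∑[ j < n ] 𝟙 (b ∧ p (Fin.suc j)) + pairCount n (λ i j → p (Fin.suc i) ∧ p (Fin.suc j))
             ≡ (𝟙 b + k) C 2
  peel true = trans (cong (k +_) rest) (sym ([1+n]C2≡n+nC2 k))
  peel false = cong₂ _+_ (sum-replicate-zero n) rest

pairCount-true : ∀ n → pairCount n (λ _ _ → true) ≡ n C 2
pairCount-true n = trans (pairCount-both n (λ _ → true)) (cong (_C 2) (∑-ones n))

pairCell : ∀ {n} → (Fin n → Fin n → Bool) → Fin n → Fin n → List (Fin n × Fin n)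
pairCell Q i j = if (toℕ i <ᵇ toℕ j) ∧ Q i j then [ (i , j) ] else []

pairList : ∀ {n} → (Fin n → Fin n → Bool) → List (Fin n × Fin n)
pairList {n} Q = concatMap (λ i → concatMap (pairCell Q i) (allFin n)) (allFin n)

module _ {A : Set} where

  length-if : ∀ b (x : A) → length (if b then [ x ] else []) ≡ 𝟙 b
  length-if true x = refl
  length-if false x = refl

  if-unique : ∀ b (x : A) → Unique (if b then [ x ] else [])
  if-unique true x = All.[] ∷ []
  if-unique false x = []

  ∈-if⁻ : ∀ {b} {x y : A} → y ∈ (if b then [ x ] else []) → y ≡ x × b ≡ true
  ∈-if⁻ {true} (here y≡x) = y≡x , refl

  length-concatMap-tabulate : ∀ {B : Set} n (g : Fin n → A) (f : A → List B) →
    length (concatMap f (tabulate g)) ≡ ∑[ i < n ] length (f (g i))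
  length-concatMap-tabulate zero g f = refl
  length-concatMap-tabulate (suc n) g f = trans (length-++ (f (g Fin.zero)))
    (cong (length (f (g Fin.zero)) +_) (length-concatMap-tabulate n (λ i → g (Fin.suc i)) f))

  concatMap-unique : ∀ {B : Set} (f : A → List B) (index : B → A) {xs : List A} → Unique xs →
    (∀ x → Unique (f x)) → (∀ {x y} → y ∈ f x → index y ≡ x) → Unique (concatMap f xs)
  concatMap-unique f index {[]} _ _ _ = []
  concatMap-unique f index {x ∷ xs} (x∉xs ∷ xs!) f! indexed =
    Unique.++⁺ (f! x) (concatMap-unique f index xs! f! indexed) disjoint
    where
    disjoint : ∀ {y} → ¬ (y ∈ f x × y ∈ concatMap f xs)
    disjoint (y∈fx , y∈rest) with x′ , x′∈xs , y∈fx′ ← find (∈-concatMap⁻ f y∈rest) =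
      All.lookup x∉xs x′∈xs (trans (sym (indexed y∈fx)) (indexed y∈fx′))

length-pairList : ∀ {n} (Q : Fin n → Fin n → Bool) → length (pairList Q) ≡ pairCount n Q
length-pairList {n} Q =
  trans (length-concatMap-tabulate n (λ i → i) (λ i → concatMap (pairCell Q i) (allFin n))) (sum-cong-≗ λ i →
  trans (length-concatMap-tabulate n (λ j → j) (pairCell Q i))
        (sum-cong-≗ λ j → length-if ((toℕ i <ᵇ toℕ j) ∧ Q i j) (i , j)))

∈-pairList⁻ : ∀ {n} {Q : Fin n → Fin n → Bool} {i j} → (i , j) ∈ pairList Q →
  toℕ i < toℕ j × Q i j ≡ true
∈-pairList⁻ {n} {Q} {i} {j} ij∈
  with _ , _ , ij∈row ← find (∈-concatMap⁻ _ {xs = allFin n} ij∈)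
  with _ , _ , ij∈cell ← find (∈-concatMap⁻ _ {xs = allFin n} ij∈row)
  with ∈-if⁻ ij∈cell
... | refl , i<ᵇj∧Qij with i<ᵇj , Qij ← ∧-true⁻ i<ᵇj∧Qij = <ᵇ⇒<′ i<ᵇj , Qij

∈-pairList⁺ : ∀ {n} {Q : Fin n → Fin n → Bool} {i j} → toℕ i < toℕ j → Q i j ≡ true →
  (i , j) ∈ pairList Q
∈-pairList⁺ {n} {Q} {i} {j} i<j Qij =
  ∈-concatMap⁺ _ (lose (∈-allFin i) (∈-concatMap⁺ _ (lose (∈-allFin j) ij∈cell)))
  where
  ij∈cell : (i , j) ∈ (if (toℕ i <ᵇ toℕ j) ∧ Q i j then [ (i , j) ] else [])
  ij∈cell rewrite <⇒<ᵇ′ i<j | Qij = here refl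

pairList-unique : ∀ {n} (Q : Fin n → Fin n → Bool) → Unique (pairList Q)
pairList-unique {n} Q = concatMap-unique _ proj₁ (Unique.allFin⁺ n)
  (λ i → concatMap-unique _ proj₂ (Unique.allFin⁺ n) (λ j → if-unique _ (i , j)) (λ y∈ → cong proj₂ (proj₁ (∈-if⁻ y∈))))
  λ y∈ → let _ , _ , y∈cell = find (∈-concatMap⁻ _ {xs = allFin n} y∈) in cong proj₁ (proj₁ (∈-if⁻ y∈cell))

unique⊆⇒length≤ : ∀ {A : Set} → DecidableEquality A → ∀ {xs ys : List A} → Unique xs →
  (∀ {z} → z ∈ xs → z ∈ ys) → length xs ≤ length ys
unique⊆⇒length≤ _≟_ {[]} _ _ = z≤n
unique⊆⇒length≤ _≟_ {x ∷ xs} {ys} (x∉xs ∷ xs!) xs⊆ys =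
  ≤-trans (s≤s (unique⊆⇒length≤ _≟_ xs! xs⊆others)) (filter-notAll (λ y → ¬? (x ≟ y)) ys x∈ys)
  where
  xs⊆others : ∀ {z} → z ∈ xs → z ∈ filter (λ y → ¬? (x ≟ y)) ys
  xs⊆others z∈xs = ∈-filter⁺ (λ y → ¬? (x ≟ y)) (xs⊆ys (there z∈xs)) (All.lookup x∉xs z∈xs)
  x∈ys : Any (λ y → ¬ ¬ x ≡ y) ys
  x∈ys = lose (xs⊆ys (here refl)) (λ x≢x → x≢x refl)

length-filter+length-filter-¬ : ∀ {A : Set} {P : A → Set} (P? : Decidable P) xs →
  length (filter P? xs) + length (filter (λ x → ¬? (P? x)) xs) ≡ length xs
length-filter+length-filter-¬ P? [] = refl
length-filter+length-filter-¬ P? (x ∷ xs) with P? x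
... | yes _ = cong suc (length-filter+length-filter-¬ P? xs)
... | no _ = trans (+-suc _ _) (cong suc (length-filter+length-filter-¬ P? xs))

module _ {A : Set} (_≟A_ : DecidableEquality A) where
  open import Data.List.Membership.DecPropositional _≟A_ using (_∈?_)

  distinctValues+length≤length : (f : A → ℕ) {xs rs : List A} → Unique rs → (∀ {r} → r ∈ rs → r ∈ xs) →
    (∀ {x} → x ∈ xs → ∃ λ y → y ∈ xs × y ∉ rs × f y ≡ f x) →
    length (deduplicate _≟_ (map f xs)) + length rs ≤ length xs
  distinctValues+length≤length f {xs} {rs} rs! rs⊆xs attainedOutside = begin
    length (deduplicate _≟_ (map f xs)) + length rs   ≤⟨ +-mono-≤ values≤ rs≤ ⟩
    length outside + length inside                     ≡⟨ +-comm (length outside) _ ⟩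
    length inside + length outside                     ≡⟨ length-filter+length-filter-¬ (_∈? rs) xs ⟩
    length xs                                          ∎
    where
    open ≤-Reasoning
    inside outside : List A
    inside = filter (_∈? rs) xs
    outside = filter (λ x → ¬? (x ∈? rs)) xs
    values⊆ : ∀ {v} → v ∈ deduplicate _≟_ (map f xs) → v ∈ map f outside
    values⊆ v∈ with x , x∈xs , refl ← ∈-map⁻ f (∈-deduplicate⁻ _≟_ (map f xs) v∈)
               with y , y∈xs , y∉rs , fy≡fx ← attainedOutside x∈xs =
      subst (_∈ map f outside) fy≡fx (∈-map⁺ f (∈-filter⁺ (λ x → ¬? (x ∈? rs)) y∈xs y∉rs))
    values≤ : length (deduplicate _≟_ (map f xs)) ≤ length outside
    values≤ = ≤-trans (unique⊆⇒length≤ _≟_ (deduplicate-! _≟_ (map f xs)) values⊆)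
                      (≤-reflexive (length-map f outside))
    rs≤ : length rs ≤ length inside
    rs≤ = unique⊆⇒length≤ _≟A_ rs! (λ r∈rs → ∈-filter⁺ (_∈? rs) (rs⊆xs r∈rs) r∈rs)

length-filter-tabulate : ∀ {A : Set} {P : A → Set} (P? : Decidable P) n (g : Fin n → A) →
  length (filter P? (tabulate g)) ≡ ∑[ i < n ] 𝟙 (does (P? (g i)))
length-filter-tabulate P? zero g = refl
length-filter-tabulate P? (suc n) g with does (P? (g Fin.zero))
... | true = cong suc (length-filter-tabulate P? n (λ i → g (Fin.suc i)))
... | false = length-filter-tabulate P? n (λ i → g (Fin.suc i))

pairCount-cong : ∀ n {Q R : Fin n → Fin n → Bool} → (∀ i j → Q i j ≡ R i j) → pairCount n Q ≡ pairCount n R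
pairCount-cong n Q≗R = sum-cong-≗ λ i → sum-cong-≗ λ j → cong (λ b → 𝟙 ((toℕ i <ᵇ toℕ j) ∧ b)) (Q≗R i j)

orient : ∀ {n} → Fin n → Fin n → Fin n × Fin n
orient i j = if toℕ i <ᵇ toℕ j then (i , j) else (j , i)

orient-< : ∀ {n} {i j : Fin n} → toℕ i < toℕ j → orient i j ≡ (i , j)
orient-< i<j rewrite <⇒<ᵇ′ i<j = refl

orient-comm : ∀ {n} (i j : Fin n) → orient i j ≡ orient j i
orient-comm i j with toℕ i <ᵇ toℕ j in i<j | toℕ j <ᵇ toℕ i in j<i
... | true | true = contradiction (<ᵇ⇒<′ {toℕ j} {toℕ i} j<i) (<⇒≯ (<ᵇ⇒<′ i<j))
... | true | false = refl
... | false | true = refl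
... | false | false = cong₂ _,_ j≡i (sym j≡i)
  where
  j≡i : j ≡ i
  j≡i = Fin.toℕ-injective (≤-antisym (<ᵇ≡false⇒≥ i<j) (<ᵇ≡false⇒≥ j<i))

orient-injective : ∀ {n} {a b c d : Fin n} → orient a b ≡ orient c d → a ≡ c ⊎ (a ≡ d × b ≡ c)
orient-injective {a = a} {b} {c} {d} eq with toℕ a <ᵇ toℕ b | toℕ c <ᵇ toℕ d | eq
... | true | true | refl = inj₁ refl
... | true | false | refl = inj₂ (refl , refl)
... | false | true | refl = inj₂ (refl , refl)
... | false | false | refl = inj₁ refl

orient∈edgeList : ∀ {n} (G : Graph n) {a b} → adj G a b ≡ true → orient a b ∈ edgeList G
orient∈edgeList G {a} {b} ab∈E with toℕ a <ᵇ toℕ b in a<b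
... | true = ∈-pairList⁺ (<ᵇ⇒<′ a<b) ab∈E
... | false = ∈-pairList⁺ (≤∧≢⇒< (<ᵇ≡false⇒≥ a<b) b≢a) (trans (adj-sym G b a) ab∈E)
  where
  b≢a : toℕ b ≢ toℕ a
  b≢a b≡a = contradiction (trans (sym ab∈E) aa∉E) λ ()
    where
    aa∉E : adj G a b ≡ false
    aa∉E = subst (λ x → adj G a x ≡ false) (sym (Fin.toℕ-injective b≡a)) (irrefl G a)

ecol-orient : ∀ {n} (κ : TotalColoring n) a b → ecol κ (proj₁ (orient a b)) (proj₂ (orient a b)) ≡ ecol κ a b
ecol-orient κ a b with toℕ a <ᵇ toℕ b
... | true = refl
... | false = ecol-sym κ b a

IsTMC⇒Connected : ∀ {n} {G : Graph n} {κ : TotalColoring n} → IsTMC G κ → Connected G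
IsTMC⇒Connected tmc u v u≢v = let ws , path , _ = tmc u v u≢v in ws , path

numEdges+nonEdges : ∀ {n} (G : Graph n) → numEdges G + pairCount n (λ i j → not (adj G i j)) ≡ n C 2
numEdges+nonEdges {n} G = begin
  numEdges G + pairCount n (λ i j → not (adj G i j))   ≡⟨ cong (_+ pairCount n (λ i j → not (adj G i j))) (length-pairList (adj G)) ⟩
  pairCount n (adj G) + pairCount n (λ i j → not (adj G i j)) ≡⟨ pairCount-split n (λ _ _ → true) (adj G) ⟩
  pairCount n (λ _ _ → true)                           ≡⟨ pairCount-true n ⟩
  n C 2                                                ∎
  where open ≡-Reasoning

Element : ℕ → Set
Element n = Fin n ⊎ (Fin n × Fin n)

_≟ᴱ_ : ∀ {n} → DecidableEquality (Element n)
_≟ᴱ_ = Sum.≡-dec Fin._≟_ (Product.≡-dec Fin._≟_ Fin._≟_)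

elements : ∀ {n} → Graph n → List (Element n)
elements {n} G = map inj₁ (allFin n) ++ map inj₂ (edgeList G)

colour : ∀ {n} → TotalColoring n → Element n → ℕ
colour κ (inj₁ v) = vcol κ v
colour κ (inj₂ (i , j)) = ecol κ i j

numColors≡ : ∀ {n} (G : Graph n) κ → numColors G κ ≡ length (deduplicate _≟_ (map (colour κ) (elements G)))
numColors≡ {n} G κ = cong (λ cs → length (deduplicate _≟_ cs)) (sym (begin
  map (colour κ) (map inj₁ (allFin n) ++ map inj₂ (edgeList G))
    ≡⟨ map-++ (colour κ) (map inj₁ (allFin n)) _ ⟩
  map (colour κ) (map inj₁ (allFin n)) ++ map (colour κ) (map inj₂ (edgeList G))
    ≡⟨ cong₂ _++_ (sym (map-∘ (allFin n))) (sym (map-∘ (edgeList G))) ⟩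
  map (vcol κ) (allFin n) ++ map (λ e → ecol κ (proj₁ e) (proj₂ e)) (edgeList G) ∎))
  where open ≡-Reasoning

length-elements : ∀ {n} (G : Graph n) → length (elements G) ≡ n + numEdges G
length-elements {n} G = trans (length-++ (map inj₁ (allFin n)))
  (cong₂ _+_ (trans (length-map inj₁ (allFin n)) (length-tabulate (λ i → i))) (length-map inj₂ (edgeList G)))

module NonNeighbours {n} (G : Graph n) (κ : TotalColoring n) (tmc : IsTMC G κ) where

  HasNonNeighbour : Fin n → Set
  HasNonNeighbour u = ∃ λ v → u ≢ v × adj G u v ≡ false

  hasNonNeighbour? : Decidable HasNonNeighbour
  hasNonNeighbour? u = Fin.any? λ v → ¬? (u Fin.≟ v) ×-dec (adj G u v Bool.≟ false)

  withNonNeighbour : List (Fin n)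
  withNonNeighbour = filter hasNonNeighbour? (allFin n)

  firstStep : ∀ {u} → HasNonNeighbour u → ∃ λ x → adj G u x ≡ true × ecol κ u x ≡ vcol κ x
  firstStep (v , u≢v , uv∉E) with tmc _ v u≢v
  ... | [] , (_ , uv∈E , _) , _ = contradiction (trans (sym uv∈E) uv∉E) λ ()
  ... | x ∷ _ , (_ , ux∈E , _) , (_ , vcol≡c All.∷ _ , ecol≡c , _) = x , ux∈E , trans ecol≡c (sym vcol≡c)

  next : Fin n → Fin n
  next u with hasNonNeighbour? u
  ... | yes h = proj₁ (firstStep h)
  ... | no _ = u

  next-step : ∀ {u} → HasNonNeighbour u → adj G u (next u) ≡ true × ecol κ u (next u) ≡ vcol κ (next u)
  next-step {u} h with hasNonNeighbour? u
  ... | yes h′ = proj₂ (firstStep h′)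
  ... | no ¬h = contradiction h ¬h

  next≢⇒HasNonNeighbour : ∀ {u} → next u ≢ u → HasNonNeighbour u
  next≢⇒HasNonNeighbour {u} next≢u with hasNonNeighbour? u
  ... | yes h = h
  ... | no _ = contradiction refl next≢u

  UpperOfPair : Fin n → Set
  UpperOfPair u = next (next u) ≡ u × toℕ (next u) < toℕ u

  upperOfPair? : Decidable UpperOfPair
  upperOfPair? u = (next (next u) Fin.≟ u) ×-dec (toℕ (next u) <? toℕ u)

  -- Of a pair u ⇄ next u only the smaller vertex is charged the edge between them; the
  -- larger is charged itself, its colour recurring at its partner.
  charged : Fin n → Element n
  charged u with upperOfPair? u
  ... | yes _ = inj₁ u
  ... | no _ = inj₂ (orient u (next u))

  ¬UpperOfPair⇒≤ : ∀ {u} → ¬ UpperOfPair u → next (next u) ≡ u → toℕ u ≤ toℕ (next u)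
  ¬UpperOfPair⇒≤ ¬upper back = ≮⇒≥ λ next<u → ¬upper (back , next<u)

  charged-injective : ∀ {u w} → charged u ≡ charged w → u ≡ w
  charged-injective {u} {w} eq with upperOfPair? u | upperOfPair? w
  ... | yes _ | yes _ = Sum.inj₁-injective eq
  ... | no ¬upper-u | no ¬upper-w with orient-injective (Sum.inj₂-injective eq)
  ...   | inj₁ u≡w = u≡w
  ...   | inj₂ (u≡next-w , next-u≡w) = Fin.toℕ-injective (≤-antisym u≤w w≤u)
    where
    u≤w : toℕ u ≤ toℕ w
    u≤w = subst (λ x → toℕ u ≤ toℕ x) next-u≡w
            (¬UpperOfPair⇒≤ ¬upper-u (trans (cong next next-u≡w) (sym u≡next-w)))
    w≤u : toℕ w ≤ toℕ u
    w≤u = subst (λ x → toℕ w ≤ toℕ x) (sym u≡next-w)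
            (¬UpperOfPair⇒≤ ¬upper-w (trans (cong next (sym u≡next-w)) next-u≡w))

  charged∈elements : ∀ {u} → HasNonNeighbour u → charged u ∈ elements G
  charged∈elements {u} h with upperOfPair? u
  ... | yes _ = ∈-++⁺ˡ (∈-map⁺ inj₁ (∈-allFin u))
  ... | no _ = ∈-++⁺ʳ (map inj₁ (allFin n)) (∈-map⁺ inj₂ (orient∈edgeList G (proj₁ (next-step h))))

  charged-vertex⇒UpperOfPair : ∀ {z} → inj₁ z ∈ map charged withNonNeighbour → UpperOfPair z
  charged-vertex⇒UpperOfPair z∈ with w , _ , eq ← ∈-map⁻ charged z∈ with upperOfPair? w | eq
  ... | yes upper | refl = upper

  vertexColour-repeated : ∀ y → ∃ λ z → ¬ UpperOfPair z × vcol κ z ≡ vcol κ y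
  vertexColour-repeated y with upperOfPair? y
  ... | no ¬upper = y , ¬upper , refl
  ... | yes (back , next<y) = next y , ¬upper , colours
    where
    ¬upper : ¬ UpperOfPair (next y)
    ¬upper (_ , y<next) = <-asym next<y (subst (λ x → toℕ x < toℕ (next y)) back y<next)
    next≢y : next y ≢ y
    next≢y eq = <-irrefl (cong toℕ eq) next<y
    colours : vcol κ (next y) ≡ vcol κ y
    colours = begin
      vcol κ (next y)                  ≡⟨ proj₂ (next-step (next≢⇒HasNonNeighbour next≢y)) ⟨
      ecol κ y (next y)                ≡⟨ ecol-sym κ y (next y) ⟩
      ecol κ (next y) y                ≡⟨ cong (ecol κ (next y)) back ⟨
      ecol κ (next y) (next (next y))  ≡⟨ proj₂ (next-step (next≢⇒HasNonNeighbour λ eq → next≢y (sym (trans (sym back) eq)))) ⟩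
      vcol κ (next (next y))           ≡⟨ cong (vcol κ) back ⟩
      vcol κ y                         ∎
      where open ≡-Reasoning

  open import Data.List.Membership.DecPropositional (_≟ᴱ_ {n}) using (_∈?_)

  vertexColour-attainedOutside : ∀ z → ∃ λ y →
    y ∈ elements G × y ∉ map charged withNonNeighbour × colour κ y ≡ vcol κ z
  vertexColour-attainedOutside z with y , ¬upper , colours ← vertexColour-repeated z =
    inj₁ y , ∈-++⁺ˡ (∈-map⁺ inj₁ (∈-allFin y)) , (λ y∈ → ¬upper (charged-vertex⇒UpperOfPair y∈)) , colours

  colour-attainedOutside : ∀ {x} → x ∈ elements G → ∃ λ y →
    y ∈ elements G × y ∉ map charged withNonNeighbour × colour κ y ≡ colour κ x
  colour-attainedOutside {inj₁ z} _ = vertexColour-attainedOutside z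
  colour-attainedOutside {inj₂ e} e∈ with inj₂ e ∈? map charged withNonNeighbour
  ... | no e∉ = inj₂ e , e∈ , e∉ , refl
  ... | yes e∈charged with u , u∈ , eq ← ∈-map⁻ charged e∈charged with upperOfPair? u | eq
  ...   | no _ | refl with y , y∈ , y∉ , colours ← vertexColour-attainedOutside (next u) =
    y , y∈ , y∉ , trans colours (sym (trans (ecol-orient κ u (next u)) (proj₂ (next-step hu))))
    where
    hu : HasNonNeighbour u
    hu = proj₂ (∈-filter⁻ hasNonNeighbour? {xs = allFin n} u∈)

  numColors+nonNeighboured≤ : numColors G κ + length withNonNeighbour ≤ n + numEdges G
  numColors+nonNeighboured≤ = begin
    numColors G κ + length withNonNeighbour
      ≡⟨ cong₂ _+_ (numColors≡ G κ) (sym (length-map charged withNonNeighbour)) ⟩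
    length (deduplicate _≟_ (map (colour κ) (elements G))) + length (map charged withNonNeighbour)
      ≤⟨ distinctValues+length≤length _≟ᴱ_ (colour κ) charged-unique charged⊆elements colour-attainedOutside ⟩
    length (elements G)
      ≡⟨ length-elements G ⟩
    n + numEdges G ∎
    where
    open ≤-Reasoning
    charged-unique : Unique (map charged withNonNeighbour)
    charged-unique = Unique.map⁺ charged-injective (Unique.filter⁺ hasNonNeighbour? (Unique.allFin⁺ n))
    charged⊆elements : ∀ {r} → r ∈ map charged withNonNeighbour → r ∈ elements G
    charged⊆elements r∈ with u , u∈ , refl ← ∈-map⁻ charged r∈ =
      charged∈elements (proj₂ (∈-filter⁻ hasNonNeighbour? {xs = allFin n} u∈))

  nonEdges≤ : pairCount n (λ i j → not (adj G i j)) ≤ length withNonNeighbour C 2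
  nonEdges≤ = begin
    pairCount n (λ i j → not (adj G i j))  ≤⟨ pairCount-mono-≤ n endpointsHave ⟩
    pairCount n (λ i j → has i ∧ has j)    ≡⟨ pairCount-both n has ⟩
    (∑[ i < n ] 𝟙 (has i)) C 2             ≡⟨ cong (_C 2) (length-filter-tabulate hasNonNeighbour? n (λ i → i)) ⟨
    length withNonNeighbour C 2            ∎
    where
    open ≤-Reasoning
    has : Fin n → Bool
    has i = does (hasNonNeighbour? i)
    endpointsHave : ∀ i j → toℕ i < toℕ j → not (adj G i j) ≡ true → has i ∧ has j ≡ true
    endpointsHave i j i<j ij∉E = cong₂ _∧_
      (dec-true (hasNonNeighbour? i) (j , i≢j , not≡true⇒≡false ij∉E))
      (dec-true (hasNonNeighbour? j) (i , (λ j≡i → i≢j (sym j≡i)) , trans (adj-sym G j i) (not≡true⇒≡false ij∉E)))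
      where
      i≢j : i ≢ j
      i≢j i≡j = <-irrefl (cong toℕ i≡j) i<j

fewEdges⇒manyNonNeighboured : ∀ {n d t m k} → n ≡ d + t → 2 ≤ t →
  m ≤ d C 2 + t * d + (t ∸ 2) → n C 2 ≤ m + k C 2 → t ≤ k
fewEdges⇒manyNonNeighboured {n} {d} {t@(suc (suc s))} {m} {k} refl (s≤s (s≤s z≤n)) few many with t ≤? k
... | yes t≤k = t≤k
... | no t≰k = contradiction (begin-strict
      n C 2                                  ≤⟨ many ⟩
      m + k C 2                              ≤⟨ +-mono-≤ few (C2-mono-≤ (≤-pred (≰⇒> t≰k))) ⟩
      d C 2 + t * d + s + suc s C 2          <⟨ n<1+n _ ⟩
      suc (d C 2 + t * d + s + suc s C 2)    ≡⟨ nC2 ⟨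
      n C 2                                  ∎) (<-irrefl refl)
  where
  open ≤-Reasoning
  nC2 : n C 2 ≡ suc (d C 2 + t * d + s + suc s C 2)
  nC2 = begin-equality
    (d + t) C 2                            ≡⟨ C2-+ d t ⟩
    d C 2 + d * t + t C 2                  ≡⟨ cong (d C 2 + d * t +_) ([1+n]C2≡n+nC2 (suc s)) ⟩
    d C 2 + d * t + (suc s + suc s C 2)    ≡⟨ shuffle (d C 2) d s (suc s C 2) ⟩
    suc (d C 2 + t * d + s + suc s C 2)    ∎
    where
    shuffle : ∀ x d s y → x + d * suc (suc s) + (suc s + y) ≡ suc (x + suc (suc s) * d + s + y)
    shuffle = solve-∀

numColors≤ : ∀ {n} d t → n ≡ d + t → 2 ≤ t → (G : Graph n) →
  numEdges G ≤ d C 2 + t * d + (t ∸ 2) →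
  ∀ κ → IsTMC G κ → numColors G κ ≤ numEdges G + n ∸ t
numColors≤ {n} d t n≡d+t 2≤t G few κ tmc = m+n≤o⇒m≤o∸n (numColors G κ) (begin
  numColors G κ + t                          ≤⟨ +-monoʳ-≤ (numColors G κ) t≤k ⟩
  numColors G κ + length withNonNeighbour    ≤⟨ numColors+nonNeighboured≤ ⟩
  n + numEdges G                             ≡⟨ +-comm n (numEdges G) ⟩
  numEdges G + n                             ∎)
  where
  open NonNeighbours G κ tmc
  open ≤-Reasoning
  t≤k : t ≤ length withNonNeighbour
  t≤k = fewEdges⇒manyNonNeighboured n≡d+t 2≤t few (begin
    n C 2                                                   ≡⟨ numEdges+nonEdges G ⟨
    numEdges G + pairCount n (λ i j → not (adj G i j))      ≤⟨ +-monoʳ-≤ (numEdges G) nonEdges≤ ⟩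
    numEdges G + length withNonNeighbour C 2                ∎)

touches : (d J a b : ℕ) → Bool
touches d J a b = (a <ᵇ d) ∨ ((a ≡ᵇ d) ∧ (b <ᵇ d + suc J))

extremalAdj : (d J a b : ℕ) → Bool
extremalAdj d J a b = (touches d J a b ∨ touches d J b a) ∧ not (a ≡ᵇ b)

extremalGraph : ∀ {N} (d J : ℕ) → Graph N
extremalGraph d J = record
  { adj = λ i j → extremalAdj d J (toℕ i) (toℕ j)
  ; adj-sym = λ i j → cong₂ _∧_ (Bool.∨-comm (touches d J (toℕ i) (toℕ j)) _) (cong not (≡ᵇ-sym (toℕ i) (toℕ j)))
  ; irrefl = λ i → let touches-i = touches d J (toℕ i) (toℕ i) ∨ touches d J (toℕ i) (toℕ i) in
      trans (cong (λ b → touches-i ∧ not b) (dec-true (toℕ i ≟ toℕ i) refl)) (Bool.∧-zeroʳ touches-i)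
  }

pairCount-extremal : ∀ d M J → pairCount (d + M) (λ i j → extremalAdj d J (toℕ i) (toℕ j))
                     ≡ d * M + d C 2 + pairCount M (λ i j → extremalAdj 0 J (toℕ i) (toℕ j))
pairCount-extremal zero M J = refl
pairCount-extremal (suc d) M J = begin
  ∑[ j < d + M ] 1 + pairCount (d + M) (λ i j → extremalAdj d J (toℕ i) (toℕ j))
    ≡⟨ cong₂ _+_ (∑-ones (d + M)) (pairCount-extremal d M J) ⟩
  d + M + (d * M + d C 2 + P)     ≡⟨ shuffle d M (d C 2) P ⟩
  M + d * M + (d + d C 2) + P     ≡⟨ cong (λ c → M + d * M + c + P) ([1+n]C2≡n+nC2 d) ⟨
  suc d * M + suc d C 2 + P       ∎
  where
  open ≡-Reasoning
  P : ℕ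
  P = pairCount M (λ i j → extremalAdj 0 J (toℕ i) (toℕ j))
  shuffle : ∀ d M c P → d + M + (d * M + c + P) ≡ M + d * M + (d + c) + P
  shuffle = solve-∀

pairCount-extremal-0 : ∀ M J → J ≤ M → pairCount (suc M) (λ i j → extremalAdj 0 J (toℕ i) (toℕ j)) ≡ J
pairCount-extremal-0 M J J≤M = begin
  ∑[ j < M ] 𝟙 (((toℕ j <ᵇ J) ∨ false) ∧ true) + pairCount M (λ _ _ → false)
    ≡⟨ cong₂ _+_ (sum-cong-≗ {M} λ j → cong 𝟙 (simplify (toℕ j <ᵇ J))) (pairCount-false M) ⟩
  ∑[ j < M ] 𝟙 (toℕ j <ᵇ J) + 0   ≡⟨ +-identityʳ (∑[ j < M ] 𝟙 (toℕ j <ᵇ J)) ⟩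
  ∑[ j < M ] 𝟙 (toℕ j <ᵇ J)       ≡⟨ ∑-count-< J≤M ⟩
  J                               ∎
  where
  open ≡-Reasoning
  simplify : ∀ b → (b ∨ false) ∧ true ≡ b
  simplify b = trans (Bool.∧-identityʳ _) (Bool.∨-identityʳ b)

extremalAdj-universal : ∀ {d J a b} → a ≢ b → a < d → extremalAdj d J a b ≡ true
extremalAdj-universal {d} {J} {a} {b} a≢b a<d rewrite <⇒<ᵇ′ a<d | dec-false (a ≟ b) a≢b = refl

spoke : (d a b : ℕ) → Bool
spoke d a b = ((b ≡ᵇ 0) ∧ not (a <ᵇ d)) ∨ ((a ≡ᵇ 0) ∧ not (b <ᵇ d))

-- The hub 0 and the spokes from it to the vertices b ≥ d share colour 0; all other
-- vertices and edges get distinct colours, vertices below N and edges from N on.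
extremalColouring : ∀ {N} (d : ℕ) → TotalColoring N
extremalColouring {N} d = record
  { vcol = toℕ
  ; ecol = λ i j → if spoke d (toℕ i) (toℕ j) then 0 else N + toℕ (uncurry Fin.combine (orient i j))
  ; ecol-sym = λ i j → cong₂ (λ s e → if s then 0 else N + toℕ (uncurry Fin.combine e))
                             (Bool.∨-comm ((toℕ j ≡ᵇ 0) ∧ not (toℕ i <ᵇ d)) _) (orient-comm i j)
  }

module Extremal (d′ t J : ℕ) where

  N : ℕ
  N = suc d′ + t

  G : Graph N
  G = extremalGraph (suc d′) J

  κ : TotalColoring N
  κ = extremalColouring (suc d′)

  numEdges-extremal : J < t → numEdges G ≡ suc d′ * t + suc d′ C 2 + J
  numEdges-extremal (s≤s J≤t′) = begin
    numEdges G                      ≡⟨ length-pairList (adj G) ⟩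
    pairCount N (adj G)             ≡⟨ pairCount-extremal (suc d′) t J ⟩
    suc d′ * t + suc d′ C 2 + pairCount t (λ i j → extremalAdj 0 J (toℕ i) (toℕ j))
      ≡⟨ cong (suc d′ * t + suc d′ C 2 +_) (pairCount-extremal-0 _ J J≤t′) ⟩
    suc d′ * t + suc d′ C 2 + J     ∎
    where open ≡-Reasoning

  spokes : pairCount N (λ i j → adj G i j ∧ spoke (suc d′) (toℕ i) (toℕ j)) ≡ t
  spokes = begin
    ∑[ j < d′ + t ] 𝟙 (not (toℕ j <ᵇ d′)) + pairCount (d′ + t) (λ i j → extremalAdj d′ J (toℕ i) (toℕ j) ∧ false)
      ≡⟨ cong₂ _+_ (∑-count-≥ (d′ + t) d′)
                   (trans (pairCount-cong (d′ + t) λ _ _ → Bool.∧-zeroʳ _) (pairCount-false (d′ + t))) ⟩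
    d′ + t ∸ d′ + 0    ≡⟨ +-identityʳ (d′ + t ∸ d′) ⟩
    d′ + t ∸ d′        ≡⟨ m+n∸m≡n d′ t ⟩
    t                  ∎
    where open ≡-Reasoning

  nonadjacent⇒≥ : ∀ {a b} → a ≢ b → extremalAdj (suc d′) J a b ≡ false → suc d′ ≤ a
  nonadjacent⇒≥ a≢b ab∉E = ≮⇒≥ λ a<d → contradiction (trans (sym (extremalAdj-universal a≢b a<d)) ab∉E) λ ()

  hub-adj : ∀ v → v ≢ Fin.zero → adj G Fin.zero v ≡ true
  hub-adj Fin.zero v≢0 = contradiction refl v≢0
  hub-adj (Fin.suc v) _ = refl

  hub-spoke : ∀ v → suc d′ ≤ toℕ v → ecol κ Fin.zero v ≡ 0
  hub-spoke (Fin.suc v) (s≤s d′≤v) rewrite dec-false (toℕ v <? d′) (≤⇒≯ d′≤v) = refl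

  isTMC : IsTMC G κ
  isTMC u v u≢v with adj G u v in uv∈E
  ... | true = [] , ((u≢v All.∷ All.[]) ∷ All.[] ∷ [] , uv∈E , tt) , ecol κ u v , All.[] , refl , tt
  ... | false = Fin.zero ∷ [] , (unique , u0∈E , hub-adj v v≢0 , tt) , 0 , refl All.∷ All.[] , u0-spoke , hub-spoke v d≤v , tt
    where
    d≤u : suc d′ ≤ toℕ u
    d≤u = nonadjacent⇒≥ (λ eq → u≢v (Fin.toℕ-injective eq)) uv∈E
    d≤v : suc d′ ≤ toℕ v
    d≤v = nonadjacent⇒≥ (λ eq → u≢v (Fin.toℕ-injective (sym eq))) (trans (adj-sym G v u) uv∈E)
    ≢0 : ∀ {w} → suc d′ ≤ toℕ w → w ≢ Fin.zero
    ≢0 d≤w refl = contradiction d≤w λ ()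
    u≢0 : u ≢ Fin.zero
    u≢0 = ≢0 d≤u
    v≢0 : v ≢ Fin.zero
    v≢0 = ≢0 d≤v
    unique : Unique (u ∷ Fin.zero ∷ v ∷ [])
    unique = (u≢0 All.∷ u≢v All.∷ All.[]) ∷ ((λ 0≡v → v≢0 (sym 0≡v)) All.∷ All.[]) ∷ All.[] ∷ []
    u0∈E : adj G u Fin.zero ≡ true
    u0∈E = trans (adj-sym G u Fin.zero) (hub-adj u u≢0)
    u0-spoke : ecol κ u Fin.zero ≡ 0
    u0-spoke = trans (ecol-sym κ u Fin.zero) (hub-spoke u d≤u)

  nonSpoke : Fin N → Fin N → Bool
  nonSpoke i j = adj G i j ∧ not (spoke (suc d′) (toℕ i) (toℕ j))

  code : Fin N × Fin N → ℕ
  code (i , j) = N + toℕ (Fin.combine i j)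

  code-injective : ∀ {e e′} → code e ≡ code e′ → e ≡ e′
  code-injective {i , j} {i′ , j′} eq with refl , refl ←
    Fin.combine-injective i j i′ j′ (Fin.toℕ-injective (+-cancelˡ-≡ N _ _ eq)) = refl

  distinctColours : List ℕ
  distinctColours = map toℕ (allFin N) ++ map code (pairList nonSpoke)

  distinctColours-unique : Unique distinctColours
  distinctColours-unique = Unique.++⁺ (Unique.map⁺ Fin.toℕ-injective (Unique.allFin⁺ N))
    (Unique.map⁺ code-injective (pairList-unique nonSpoke)) disjoint
    where
    disjoint : ∀ {c} → ¬ (c ∈ map toℕ (allFin N) × c ∈ map code (pairList nonSpoke))
    disjoint (c∈vertices , c∈edges)
      with v , _ , refl ← ∈-map⁻ toℕ c∈vertices
      with (i , j) , _ , eq ← ∈-map⁻ code c∈edges =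
      <⇒≱ (Fin.toℕ<n v) (subst (N ≤_) (sym eq) (m≤m+n N _))

  distinctColours⊆ : ∀ {c} → c ∈ distinctColours →
    c ∈ map (vcol κ) (allFin N) ++ map (λ e → ecol κ (proj₁ e) (proj₂ e)) (edgeList G)
  distinctColours⊆ {c} c∈ with ∈-++⁻ (map toℕ (allFin N)) c∈
  ... | inj₁ c∈vertices = ∈-++⁺ˡ c∈vertices
  ... | inj₂ c∈edges with (i , j) , ij∈ , refl ← ∈-map⁻ code c∈edges
                      with i<j , ij∈E∧¬spoke ← ∈-pairList⁻ {Q = nonSpoke} ij∈
                      with ij∈E , ¬spoke ← ∧-true⁻ ij∈E∧¬spoke =
    ∈-++⁺ʳ (map toℕ (allFin N)) (subst (_∈ _) colour≡ (∈-map⁺ (λ e → ecol κ (proj₁ e) (proj₂ e)) (∈-pairList⁺ {Q = adj G} i<j ij∈E)))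
    where
    colour≡ : ecol κ i j ≡ code (i , j)
    colour≡ = begin
      ecol κ i j
        ≡⟨ cong (λ b → if b then 0 else N + toℕ (uncurry Fin.combine (orient i j))) (not≡true⇒≡false ¬spoke) ⟩
      N + toℕ (uncurry Fin.combine (orient i j))
        ≡⟨ cong (λ e → N + toℕ (uncurry Fin.combine e)) (orient-< i<j) ⟩
      code (i , j) ∎
      where open ≡-Reasoning

  numColors-extremal-≥ : numEdges G + N ∸ t ≤ numColors G κ
  numColors-extremal-≥ = begin
    numEdges G + N ∸ t        ≡⟨ cong (λ e → e + N ∸ t) edges ⟩
    t + k + N ∸ t             ≡⟨ cong (_∸ t) (+-assoc t k N) ⟩
    t + (k + N) ∸ t           ≡⟨ m+n∸m≡n t (k + N) ⟩
    k + N                     ≡⟨ +-comm k N ⟩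
    N + k                     ≡⟨ cong₂ _+_ (trans (length-map toℕ (allFin N)) (length-tabulate {n = N} (λ i → i)))
                                           (trans (length-map code (pairList nonSpoke)) (length-pairList nonSpoke)) ⟨
    length (map toℕ (allFin N)) + length (map code (pairList nonSpoke))
                              ≡⟨ length-++ (map toℕ (allFin N)) ⟨
    length distinctColours    ≤⟨ unique⊆⇒length≤ _≟_ distinctColours-unique (λ c∈ → ∈-deduplicate⁺ _≟_ (distinctColours⊆ c∈)) ⟩
    numColors G κ             ∎
    where
    open ≤-Reasoning
    k : ℕ
    k = pairCount N nonSpoke
    edges : numEdges G ≡ t + k
    edges = trans (length-pairList (adj G))
      (trans (sym (pairCount-split N (adj G) (λ i j → spoke (suc d′) (toℕ i) (toℕ j)))) (cong (_+ k) spokes))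

sharpness : ∀ d t m → 1 ≤ d → 2 ≤ t → d C 2 + t * d ≤ m → m ≤ d C 2 + t * d + (t ∸ 2) →
  Σ (Graph (d + t)) λ G → Connected G × numEdges G ≡ m × TmcEq G (m + (d + t) ∸ t)
sharpness (suc d′) t@(suc (suc s)) m (s≤s z≤n) 2≤t@(s≤s (s≤s z≤n)) base≤m m≤max =
  G , IsTMC⇒Connected {G = G} {κ = κ} isTMC , edges , (κ , isTMC , ≤-antisym (upper κ isTMC) lower) , upper
  where
  base : ℕ
  base = suc d′ C 2 + t * suc d′
  J : ℕ
  J = m ∸ base
  J≤s : J ≤ s
  J≤s = ≤-trans (∸-monoˡ-≤ base m≤max) (≤-reflexive (m+n∸m≡n base s))
  open Extremal d′ t J
  edges : numEdges G ≡ m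
  edges = begin
    numEdges G                        ≡⟨ numEdges-extremal (s≤s (m≤n⇒m≤1+n J≤s)) ⟩
    suc d′ * t + suc d′ C 2 + J       ≡⟨ cong (_+ J) (swap (suc d′) t (suc d′ C 2)) ⟩
    base + J                          ≡⟨ m+[n∸m]≡n base≤m ⟩
    m                                 ∎
    where
    open ≡-Reasoning
    swap : ∀ d t c → d * t + c ≡ c + t * d
    swap = solve-∀
  lower : m + N ∸ t ≤ numColors G κ
  lower = subst (λ e → e + N ∸ t ≤ numColors G κ) edges numColors-extremal-≥
  upper : ∀ κ′ → IsTMC G κ′ → numColors G κ′ ≤ m + N ∸ t
  upper κ′ tmc = subst (λ e → numColors G κ′ ≤ e + N ∸ t) edges
    (numColors≤ (suc d′) t refl 2≤t G (≤-trans (≤-reflexive edges) m≤max) κ′ tmc)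

lemma7 : ∀ (n t : ℕ) → 2 ≤ t → t < n →
    ((G : Graph n) → Connected G →
    ((n ∸ t) C 2) + t * (n ∸ t) ≤ numEdges G →
    numEdges G ≤ ((n ∸ t) C 2) + t * (n ∸ t) + (t ∸ 2) →
    ∀ (κ : TotalColoring n) → IsTMC G κ → numColors G κ ≤ numEdges G + n ∸ t)
    ×
    (∀ (m : ℕ) →
    ((n ∸ t) C 2) + t * (n ∸ t) ≤ m →
    m ≤ ((n ∸ t) C 2) + t * (n ∸ t) + (t ∸ 2) →
    Σ (Graph n) λ G → Connected G × numEdges G ≡ m × TmcEq G (m + n ∸ t))
lemma7 n t 2≤t t<n = (λ G _ _ few → numColors≤ d t n≡d+t 2≤t G few) ,
  λ m base≤m m≤max → subst (λ n′ → Σ (Graph n′) λ G → Connected G × numEdges G ≡ m × TmcEq G (m + n′ ∸ t))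
    (sym n≡d+t) (sharpness d t m (m<n⇒0<n∸m t<n) 2≤t base≤m m≤max)
  where
  d : ℕ
  d = n ∸ t
  n≡d+t : n ≡ d + t
  n≡d+t = sym (m∸n+n≡m (<⇒≤ t<n))
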